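{- Let $G=(V,E)$ be a graph and $G_0=G-N[\mathrm{core}(G)]$. Then: (i) no $\alpha$-critical edge of $G$ has an endpoint in $N[\mathrm{core}(G)]$; (ii) $\alpha(G)=\alpha(G_0)+\xi(G)$, $\Omega(G_0)=\{S\cap V(G_0):S\in\Omega(G)\}$, and $\mathrm{core}(G_0)=\emptyset$; (iii) an edge $e=xy$ is an $\alpha$-critical edge of $G$ if and only if $e$ is an $\alpha$-critical edge of $G_0$.
   Context: All graphs are finite and simple; "graph" means a connected graph with at least one edge ($G_0$ need not be connected; definitions apply to it as well). $\alpha(G)$ is the stability number; $\Omega(G)$ is the set of maximum stable sets; $\mathrm{core}(G)=\bigcap\{S:S\in\Omega(G)\}$ and $\xi(G)=|\mathrm{core}(G)|$. For $A\subseteq V$, $N(A)$ is the set of vertices adjacent to some vertex of $A$, $N[A]=A\cup N(A)$, and $G-A$ is the subgraph induced by $V-A$. An edge $e$ is $\alpha$-critical if $\alpha(G-e)>\alpha(G)$, where $G-e$ is $G$ with the edge $e$ deleted. -}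

module Defs where

open import Data.Nat using (ℕ; _≤_; _<_; _+_)
open import Data.Fin using (Fin)
open import Data.Fin.Subset using (Subset; _∈_; _∉_; ∣_∣)
open import Data.Product using (Σ; ∃; ∃-syntax; _×_; _,_)
open import Data.Sum using (_⊎_)
open import Data.Empty using (⊥)
open import Relation.Nullary using (¬_)
open import Relation.Binary.PropositionalEquality using (_≡_)
open import Level using (0ℓ)
open import Function.Bundles using (_⇔_)

record SGraph (n : ℕ) : Set₁ where
  field
    V     : Fin n → Set
    E     : Fin n → Fin n → Set
    E-sym : ∀ {x y} → E x y → E y x
    E-irr : ∀ {x} → ¬ E x x
    E-V   : ∀ {x y} → E x y → V x × V y
open SGraph public

data Reach {n : ℕ} (G : SGraph n) : Fin n → Fin n → Set where
  here : ∀ {x} → Reach G x x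
  step : ∀ {x y z} → E G x y → Reach G y z → Reach G x z

Connected : ∀ {n} → SGraph n → Set
Connected G = ∀ x y → V G x → V G y → Reach G x y

-- "graph" in the paper: connected with at least one edge
IsGraph : ∀ {n} → SGraph n → Set
IsGraph G = Connected G × (∃[ x ] ∃[ y ] E G x y)

Stable : ∀ {n} → SGraph n → Subset n → Set
Stable G S = (∀ x → x ∈ S → V G x) × (∀ x y → x ∈ S → y ∈ S → ¬ E G x y)

MaxStable : ∀ {n} → SGraph n → Subset n → Set
MaxStable G S = Stable G S × (∀ T → Stable G T → ∣ T ∣ ≤ ∣ S ∣)

IsAlpha : ∀ {n} → SGraph n → ℕ → Set
IsAlpha G k = ∃[ S ] (MaxStable G S × ∣ S ∣ ≡ k)

IsCore : ∀ {n} → SGraph n → Subset n → Set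
IsCore G C = ∀ x → (x ∈ C) ⇔ (V G x × (∀ S → MaxStable G S → x ∈ S))

InClosedNbhd : ∀ {n} → SGraph n → Subset n → Fin n → Set
InClosedNbhd G A x = x ∈ A ⊎ (∃[ y ] (y ∈ A × E G y x))

_─V_ : ∀ {n} → SGraph n → (Fin n → Set) → SGraph n
G ─V A = record
  { V = λ x → V G x × ¬ A x
  ; E = λ x y → E G x y × ¬ A x × ¬ A y
  ; E-sym = λ { (e , a , b) → E-sym G e , b , a }
  ; E-irr = λ { (e , _ , _) → E-irr G e }
  ; E-V = λ { (e , a , b) → let (vx , vy) = E-V G e in (vx , a) , (vy , b) }
  }

deleteEdge : ∀ {n} → SGraph n → Fin n → Fin n → SGraph n
deleteEdge G x y = record
  { V = V G
  ; E = λ a b → E G a b × ¬ ((a ≡ x × b ≡ y) ⊎ (a ≡ y × b ≡ x))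
  ; E-sym = λ { (e , ne) → E-sym G e , λ { (Data.Sum.inj₁ (p , q)) → ne (Data.Sum.inj₂ (q , p))
                                          ; (Data.Sum.inj₂ (p , q)) → ne (Data.Sum.inj₁ (q , p)) } }
  ; E-irr = λ { (e , _) → E-irr G e }
  ; E-V = λ { (e , _) → E-V G e }
  }

AlphaCritical : ∀ {n} → SGraph n → Fin n → Fin n → Set
AlphaCritical G x y =
  E G x y × (∀ a b → IsAlpha G a → IsAlpha (deleteEdge G x y) b → a < b)

{-# OPTIONS --safe #-}
module Submission where

-- Every maximum stable set S of G contains the stable set C = core(G), so
-- S ↦ S ─ C and T ↦ T ∪ C are mutually inverse between the maximum stable sets
-- of G and those of G₀ = G − N[C], with ∣ S ∣ = ∣ S ─ C ∣ + ∣ C ∣; this is (ii).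
-- If deleting the edge xy raises α, any stable set W of G − xy larger than α(G)
-- contains x and y, and W - x and W - y are maximum stable sets of G.  Since x
-- lies in the second but not in the first, x ∉ N[C]; this is (i).  Moreover
-- C ⊆ W, and the same two maps carry such sets W between G − xy and G₀ − xy,
-- which gives (iii).

open import Defs
open import Data.Nat using (ℕ; zero; suc; _+_; _≤_; _<_; z≤n; s≤s; _≤?_; _<?_)
open import Data.Nat.Properties
  using ( module ≤-Reasoning; +-suc; +-comm; ≰⇒>; ≤-antisym; ≤-pred; ≤-trans; ≤-<-trans; <-≤-trans
        ; <-irrefl; +-monoˡ-<; +-cancelʳ-<)
open import Data.Fin using (Fin)
open import Data.Fin.Subset
  using (Subset; inside; outside; _∈_; _∉_; _⊆_; _∪_; _─_; _-_; ⁅_⁆; ∣_∣)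
  renaming (⊥ to ∅)
open import Data.Fin.Subset.Properties
  using ( _∈?_; ∉⊥; ∣p∣≤n; drop-∷-⊆; ⊆-antisym; x∈⁅x⁆; x∈⁅y⁆⇒x≡y; ∣⁅x⁆∣≡1; p─q⊆p
        ; x∈p∧x∉q⇒x∈p─q; x∈p∧x≢y⇒x∈p-y; x∈p∪q⁺; x∈p∪q⁻)
open import Data.Vec using (_∷_; []; here; there)
open import Data.Product using (∃; ∃-syntax; _×_; _,_; proj₁; proj₂)
open import Data.Sum using (_⊎_; inj₁; inj₂; [_,_]; swap)
open import Data.Empty using (⊥-elim)
open import Function using (id; _∘_)
open import Function.Bundles using (_⇔_; mk⇔; module Equivalence)
open import Relation.Nullary using (¬_)
open import Relation.Nullary.Negation using (¬¬-map)
open import Relation.Nullary.Decidable using (decidable-stable)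
open import Relation.Binary.PropositionalEquality
  using (_≡_; refl; sym; trans; cong; subst; module ≡-Reasoning)

open Equivalence using (to; from)

private
  variable
    n k : ℕ
    x y : Fin n
    C S T W : Subset n
    G H : SGraph n

∣p∣≡∣p─q∣+∣q∣ : ∀ (p q : Subset n) → q ⊆ p → ∣ p ∣ ≡ ∣ p ─ q ∣ + ∣ q ∣
∣p∣≡∣p─q∣+∣q∣ []            []            _   = refl
∣p∣≡∣p─q∣+∣q∣ (inside  ∷ p) (inside  ∷ q) q⊆p =
  trans (cong suc (∣p∣≡∣p─q∣+∣q∣ p q (drop-∷-⊆ q⊆p))) (sym (+-suc _ _))
∣p∣≡∣p─q∣+∣q∣ (inside  ∷ p) (outside ∷ q) q⊆p = cong suc (∣p∣≡∣p─q∣+∣q∣ p q (drop-∷-⊆ q⊆p))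
∣p∣≡∣p─q∣+∣q∣ (outside ∷ p) (inside  ∷ q) q⊆p with () ← q⊆p here
∣p∣≡∣p─q∣+∣q∣ (outside ∷ p) (outside ∷ q) q⊆p = ∣p∣≡∣p─q∣+∣q∣ p q (drop-∷-⊆ q⊆p)

∣p∪q∣≡∣p∣+∣q∣ : ∀ (p q : Subset n) → (∀ {x} → x ∈ p → x ∉ q) → ∣ p ∪ q ∣ ≡ ∣ p ∣ + ∣ q ∣
∣p∪q∣≡∣p∣+∣q∣ []            []            _ = refl
∣p∪q∣≡∣p∣+∣q∣ (inside  ∷ p) (inside  ∷ q) disj = ⊥-elim (disj here here)
∣p∪q∣≡∣p∣+∣q∣ (inside  ∷ p) (outside ∷ q) disj =
  cong suc (∣p∪q∣≡∣p∣+∣q∣ p q (λ x∈p x∈q → disj (there x∈p) (there x∈q)))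
∣p∪q∣≡∣p∣+∣q∣ (outside ∷ p) (inside  ∷ q) disj =
  trans (cong suc (∣p∪q∣≡∣p∣+∣q∣ p q (λ x∈p x∈q → disj (there x∈p) (there x∈q)))) (sym (+-suc _ _))
∣p∪q∣≡∣p∣+∣q∣ (outside ∷ p) (outside ∷ q) disj =
  ∣p∪q∣≡∣p∣+∣q∣ p q (λ x∈p x∈q → disj (there x∈p) (there x∈q))

x∈p─q⇒x∉q : ∀ (p q : Subset n) → x ∈ p ─ q → x ∉ q
x∈p─q⇒x∉q (_       ∷ p) (inside  ∷ q) (there x∈p─q) (there x∈q) = x∈p─q⇒x∉q p q x∈p─q x∈q
x∈p─q⇒x∉q (inside  ∷ p) (outside ∷ q) (there x∈p─q) (there x∈q) = x∈p─q⇒x∉q p q x∈p─q x∈q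
x∈p─q⇒x∉q (outside ∷ p) (outside ∷ q) (there x∈p─q) (there x∈q) = x∈p─q⇒x∉q p q x∈p─q x∈q

x∉p-x : ∀ (p : Subset n) x → x ∉ p - x
x∉p-x p x x∈p-x = x∈p─q⇒x∉q p ⁅ x ⁆ x∈p-x (x∈⁅x⁆ x)

x∈p⇒∣p∣≡1+∣p-x∣ : ∀ {p : Subset n} → x ∈ p → ∣ p ∣ ≡ suc ∣ p - x ∣
x∈p⇒∣p∣≡1+∣p-x∣ {x = x} {p} x∈p = begin
  ∣ p ∣              ≡⟨ ∣p∣≡∣p─q∣+∣q∣ p ⁅ x ⁆ (λ y∈⁅x⁆ → subst (_∈ p) (sym (x∈⁅y⁆⇒x≡y x y∈⁅x⁆)) x∈p) ⟩
  ∣ p - x ∣ + ∣ ⁅ x ⁆ ∣ ≡⟨ cong (∣ p - x ∣ +_) (∣⁅x⁆∣≡1 x) ⟩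
  ∣ p - x ∣ + 1      ≡⟨ +-comm ∣ p - x ∣ 1 ⟩
  suc ∣ p - x ∣      ∎
  where open ≡-Reasoning

infix 4 _≅_
record _≅_ (G H : SGraph n) : Set where
  field
    V⇔ : ∀ x → V G x ⇔ V H x
    E⇔ : ∀ x y → E G x y ⇔ E H x y
open _≅_

≅-sym : G ≅ H → H ≅ G
≅-sym G≅H = record
  { V⇔ = λ x → mk⇔ (from (V⇔ G≅H x)) (to (V⇔ G≅H x))
  ; E⇔ = λ x y → mk⇔ (from (E⇔ G≅H x y)) (to (E⇔ G≅H x y))
  }

stable-≅ : G ≅ H → Stable G S → Stable H S
stable-≅ G≅H (S⊆V , S-indep) =
  (λ x x∈S → to (V⇔ G≅H x) (S⊆V x x∈S)) ,
  (λ x y x∈S y∈S → S-indep x y x∈S y∈S ∘ from (E⇔ G≅H x y))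

infix 4 α[_]<_
α[_]<_ : SGraph n → ℕ → Set
α[ G ]< k = ∀ T → Stable G T → ∣ T ∣ < k

module _ (G : SGraph n) where

  stable-⊆ : T ⊆ S → Stable G S → Stable G T
  stable-⊆ T⊆S (S⊆V , S-indep) =
    (λ x → S⊆V x ∘ T⊆S) , (λ x y x∈T y∈T → S-indep x y (T⊆S x∈T) (T⊆S y∈T))

  -- V and E are arbitrary predicates, so a maximum stable set exists only up to
  -- double negation; it is only ever used towards negative or decidable goals.
  maxStable-exists : ¬ ¬ ∃ (MaxStable G)
  maxStable-exists no-max =
    stable-of-size-≥ (suc n) (λ (S , _ , n<∣S∣) → <-irrefl refl (<-≤-trans n<∣S∣ (∣p∣≤n S)))
    where
    stable-of-size-≥ : ∀ k → ¬ ¬ (∃[ S ] (Stable G S × k ≤ ∣ S ∣))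
    stable-of-size-≥ zero    none = none (∅ , ((λ _ → ⊥-elim ∘ ∉⊥) , (λ _ _ → ⊥-elim ∘ ∉⊥)) , z≤n)
    stable-of-size-≥ (suc k) none = stable-of-size-≥ k λ (S , S-stable , k≤∣S∣) →
      no-max (S , S-stable , λ T T-stable → decidable-stable (∣ T ∣ ≤? ∣ S ∣) λ ∣T∣≰∣S∣ →
        none (T , T-stable , ≤-trans (s≤s k≤∣S∣) (≰⇒> ∣T∣≰∣S∣)))

  maxStable⇒α< : MaxStable G S → α[ G ]< suc ∣ S ∣
  maxStable⇒α< (_ , S-max) T T-stable = s≤s (S-max T T-stable)

  α<⇒maxStable : Stable G S → α[ G ]< suc ∣ S ∣ → MaxStable G S
  α<⇒maxStable S-stable α<1+∣S∣ = S-stable , λ T T-stable → ≤-pred (α<1+∣S∣ T T-stable)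

  maxStable-∣∣-unique : MaxStable G S → MaxStable G T → ∣ S ∣ ≡ ∣ T ∣
  maxStable-∣∣-unique (S-stable , S-max) (T-stable , T-max) = ≤-antisym (T-max _ S-stable) (S-max _ T-stable)

infix 4 _⊆⋂Ω_
_⊆⋂Ω_ : Subset n → SGraph n → Set
C ⊆⋂Ω G = ∀ {S} → MaxStable G S → C ⊆ S

infixl 5 _─N[_]
_─N[_] : SGraph n → Subset n → SGraph n
G ─N[ C ] = G ─V InClosedNbhd G C

module _ (G : SGraph n) (C : Subset n) where

  stable-∪ : Stable G C → Stable (G ─N[ C ]) T → Stable G (T ∪ C)
  stable-∪ {T} (C⊆V , C-indep) (T⊆V₀ , T-indep) = ∪⊆V , ∪-indep
    where
    ∪⊆V : ∀ x → x ∈ T ∪ C → V G x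
    ∪⊆V x x∈T∪C = [ proj₁ ∘ T⊆V₀ x , C⊆V x ] (x∈p∪q⁻ T C x∈T∪C)

    ∪-indep : ∀ x y → x ∈ T ∪ C → y ∈ T ∪ C → ¬ E G x y
    ∪-indep x y x∈ y∈ xy with x∈p∪q⁻ T C x∈ | x∈p∪q⁻ T C y∈
    ... | inj₁ x∈T | inj₁ y∈T = T-indep x y x∈T y∈T (xy , proj₂ (T⊆V₀ x x∈T) , proj₂ (T⊆V₀ y y∈T))
    ... | inj₁ x∈T | inj₂ y∈C = proj₂ (T⊆V₀ x x∈T) (inj₂ (y , y∈C , E-sym G xy))
    ... | inj₂ x∈C | inj₁ y∈T = proj₂ (T⊆V₀ y y∈T) (inj₂ (x , x∈C , xy))
    ... | inj₂ x∈C | inj₂ y∈C = C-indep x y x∈C y∈C xy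

  ∣T∪C∣≡∣T∣+∣C∣ : Stable (G ─N[ C ]) T → ∣ T ∪ C ∣ ≡ ∣ T ∣ + ∣ C ∣
  ∣T∪C∣≡∣T∣+∣C∣ {T} (T⊆V₀ , _) = ∣p∪q∣≡∣p∣+∣q∣ T C (λ x∈T x∈C → proj₂ (T⊆V₀ _ x∈T) (inj₁ x∈C))

  stable-─ : C ⊆ S → Stable G S → Stable (G ─N[ C ]) (S ─ C)
  stable-─ {S} C⊆S (S⊆V , S-indep) =
    (λ x x∈S─C → S⊆V x (p─q⊆p S C x∈S─C) ,
       [ x∈p─q⇒x∉q S C x∈S─C , (λ (c , c∈C , cx) → S-indep c x (C⊆S c∈C) (p─q⊆p S C x∈S─C) cx) ]) ,
    (λ x y x∈ y∈ (xy , _) → S-indep x y (p─q⊆p S C x∈) (p─q⊆p S C y∈) xy)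

  α<-─N : Stable G C → α[ G ]< k + ∣ C ∣ → α[ G ─N[ C ] ]< k
  α<-─N {k} C-stable α<k+∣C∣ T T-stable = +-cancelʳ-< ∣ C ∣ ∣ T ∣ k
    (subst (_< k + ∣ C ∣) (∣T∪C∣≡∣T∣+∣C∣ T-stable) (α<k+∣C∣ (T ∪ C) (stable-∪ C-stable T-stable)))

  α<-+ : C ⊆⋂Ω G → α[ G ─N[ C ] ]< k → α[ G ]< k + ∣ C ∣
  α<-+ {k} C⊆⋂Ω α₀<k T T-stable =
    decidable-stable (∣ T ∣ <? k + ∣ C ∣) (¬¬-map via-maximum (maxStable-exists G))
    where
    open ≤-Reasoning
    via-maximum : ∃ (MaxStable G) → ∣ T ∣ < k + ∣ C ∣
    via-maximum (S , S-max) = begin-strict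
      ∣ T ∣             ≤⟨ proj₂ S-max T T-stable ⟩
      ∣ S ∣             ≡⟨ ∣p∣≡∣p─q∣+∣q∣ S C (C⊆⋂Ω S-max) ⟩
      ∣ S ─ C ∣ + ∣ C ∣ <⟨ +-monoˡ-< ∣ C ∣ (α₀<k (S ─ C) (stable-─ (C⊆⋂Ω S-max) (proj₁ S-max))) ⟩
      k + ∣ C ∣         ∎

  maxStable-─ : Stable G C → C ⊆ S → MaxStable G S → MaxStable (G ─N[ C ]) (S ─ C)
  maxStable-─ {S} C-stable C⊆S S-max = α<⇒maxStable (G ─N[ C ]) (stable-─ C⊆S (proj₁ S-max))
    (α<-─N C-stable (subst (λ m → α[ G ]< suc m) (∣p∣≡∣p─q∣+∣q∣ S C C⊆S) (maxStable⇒α< G S-max)))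

  maxStable-∪ : Stable G C → C ⊆⋂Ω G → MaxStable (G ─N[ C ]) T → MaxStable G (T ∪ C)
  maxStable-∪ C-stable C⊆⋂Ω (T-stable , T-max) = α<⇒maxStable G (stable-∪ C-stable T-stable)
    (subst (λ m → α[ G ]< suc m) (sym (∣T∪C∣≡∣T∣+∣C∣ T-stable))
      (α<-+ C⊆⋂Ω (maxStable⇒α< (G ─N[ C ]) (T-stable , T-max))))

  maxStable-∣∣-─N : Stable G C → C ⊆⋂Ω G → MaxStable G S → MaxStable (G ─N[ C ]) T → ∣ S ∣ ≡ ∣ T ∣ + ∣ C ∣
  maxStable-∣∣-─N {S} {T} C-stable C⊆⋂Ω S-max T-max = begin
    ∣ S ∣             ≡⟨ ∣p∣≡∣p─q∣+∣q∣ S C (C⊆⋂Ω S-max) ⟩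
    ∣ S ─ C ∣ + ∣ C ∣ ≡⟨ cong (_+ ∣ C ∣) (maxStable-∣∣-unique (G ─N[ C ]) S─C-max T-max) ⟩
    ∣ T ∣ + ∣ C ∣     ∎
    where
    open ≡-Reasoning
    S─C-max : MaxStable (G ─N[ C ]) (S ─ C)
    S─C-max = maxStable-─ C-stable (C⊆⋂Ω S-max) S-max

  maxStable-─N⇔ : Stable G C → C ⊆⋂Ω G →
    MaxStable (G ─N[ C ]) T ⇔ (∃[ S ] (MaxStable G S × (∀ x → x ∈ T ⇔ (x ∈ S × V (G ─N[ C ]) x))))
  maxStable-─N⇔ {T} C-stable C⊆⋂Ω = mk⇔
    (λ T-max → T ∪ C , maxStable-∪ C-stable C⊆⋂Ω T-max , λ x → mk⇔
      (λ x∈T → x∈p∪q⁺ (inj₁ x∈T) , proj₁ (proj₁ T-max) x x∈T)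
      (λ (x∈T∪C , _ , x∉N) → [ id , ⊥-elim ∘ x∉N ∘ inj₁ ] (x∈p∪q⁻ T C x∈T∪C)))
    (λ (S , S-max , T⇔) → subst (MaxStable (G ─N[ C ])) (sym (T≡S─C S-max T⇔))
      (maxStable-─ C-stable (C⊆⋂Ω S-max) S-max))
    where
    T≡S─C : MaxStable G S → (∀ x → x ∈ T ⇔ (x ∈ S × V (G ─N[ C ]) x)) → T ≡ S ─ C
    T≡S─C {S} S-max T⇔ = ⊆-antisym
      (λ x∈T → let (x∈S , _ , x∉N) = to (T⇔ _) x∈T in x∈p∧x∉q⇒x∈p─q x∈S (x∉N ∘ inj₁))
      (λ x∈S─C → from (T⇔ _) (p─q⊆p S C x∈S─C , proj₁ (stable-─ (C⊆⋂Ω S-max) (proj₁ S-max)) _ x∈S─C))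

  ∈∉maxStable⇒∉N[C] : C ⊆⋂Ω G → MaxStable G S → MaxStable G T → x ∉ S → x ∈ T → ¬ InClosedNbhd G C x
  ∈∉maxStable⇒∉N[C] {x = x} C⊆⋂Ω S-max T-max x∉S x∈T =
    [ x∉S ∘ C⊆⋂Ω S-max , (λ (c , c∈C , cx) → proj₂ (proj₁ T-max) c x (C⊆⋂Ω T-max c∈C) x∈T cx) ]

module _ (G : SGraph n) (C : Subset n) (C-core : IsCore G C) where

  core-⊆⋂Ω : C ⊆⋂Ω G
  core-⊆⋂Ω S-max x∈C = proj₂ (to (C-core _) x∈C) _ S-max

  core-stable : Stable G C
  core-stable =
    (λ x x∈C → proj₁ (to (C-core x) x∈C)) ,
    (λ x y x∈C y∈C xy → maxStable-exists G λ (S , S-max) →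
      proj₂ (proj₁ S-max) x y (core-⊆⋂Ω S-max x∈C) (core-⊆⋂Ω S-max y∈C) xy)

  core-─N[core]-empty : ¬ (V (G ─N[ C ]) x × (∀ S → MaxStable (G ─N[ C ]) S → x ∈ S))
  core-─N[core]-empty {x} ((x∈V , x∉N) , x∈⋂Ω₀) = x∉N (inj₁ (from (C-core x) (x∈V , λ S S-max →
    p─q⊆p S C (x∈⋂Ω₀ (S ─ C) (maxStable-─ G C core-stable (core-⊆⋂Ω S-max) S-max)))))

RaisesAlpha : SGraph n → Fin n → Fin n → Set
RaisesAlpha G x y = ∃[ W ] (Stable (deleteEdge G x y) W × α[ G ]< ∣ W ∣)

module _ (G : SGraph n) (x y : Fin n) where

  deleteEdge-sym : deleteEdge G x y ≅ deleteEdge G y x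
  deleteEdge-sym = record
    { V⇔ = λ _ → mk⇔ id id
    ; E⇔ = λ _ _ → mk⇔ (λ (ab , ab≢xy) → ab , ab≢xy ∘ swap) (λ (ab , ab≢yx) → ab , ab≢yx ∘ swap)
    }

  stable-deleteEdge : Stable G W → Stable (deleteEdge G x y) W
  stable-deleteEdge (W⊆V , W-indep) = W⊆V , λ a b a∈W b∈W (ab , _) → W-indep a b a∈W b∈W ab

  stable-deleteEdge⁻ : Stable (deleteEdge G x y) W → x ∉ W → Stable G W
  stable-deleteEdge⁻ {W} (W⊆V , W-indep) x∉W =
    W⊆V , λ a b a∈W b∈W ab → W-indep a b a∈W b∈W (ab , ab≢xy a∈W b∈W)
    where
    ab≢xy : ∀ {a b} → a ∈ W → b ∈ W → ¬ ((a ≡ x × b ≡ y) ⊎ (a ≡ y × b ≡ x))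
    ab≢xy a∈W _   (inj₁ (refl , _)) = x∉W a∈W
    ab≢xy _   b∈W (inj₂ (_ , refl)) = x∉W b∈W

  N[C]-deleteEdge : x ∉ C → y ∉ C → ∀ a → InClosedNbhd (deleteEdge G x y) C a ⇔ InClosedNbhd G C a
  N[C]-deleteEdge x∉C y∉C a = mk⇔
    [ inj₁ , (λ (c , c∈C , ca , _) → inj₂ (c , c∈C , ca)) ]
    [ inj₁ , (λ (c , c∈C , ca) → inj₂ (c , c∈C , ca , λ { (inj₁ (refl , _)) → x∉C c∈C
                                                        ; (inj₂ (refl , _)) → y∉C c∈C })) ]

  deleteEdge-─N : x ∉ C → y ∉ C → deleteEdge G x y ─N[ C ] ≅ deleteEdge (G ─N[ C ]) x y
  deleteEdge-─N {C} x∉C y∉C = record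
    { V⇔ = λ a → mk⇔ (λ (a∈V , a∉N′) → a∈V , ∉N′⇒∉N a a∉N′) (λ (a∈V , a∉N) → a∈V , ∉N⇒∉N′ a a∉N)
    ; E⇔ = λ a b → mk⇔
        (λ ((ab , ab≢xy) , a∉N′ , b∉N′) → (ab , ∉N′⇒∉N a a∉N′ , ∉N′⇒∉N b b∉N′) , ab≢xy)
        (λ ((ab , a∉N , b∉N) , ab≢xy) → (ab , ab≢xy) , ∉N⇒∉N′ a a∉N , ∉N⇒∉N′ b b∉N)
    }
    where
    ∉N′⇒∉N : ∀ a → ¬ InClosedNbhd (deleteEdge G x y) C a → ¬ InClosedNbhd G C a
    ∉N′⇒∉N a a∉N′ = a∉N′ ∘ from (N[C]-deleteEdge x∉C y∉C a)

    ∉N⇒∉N′ : ∀ a → ¬ InClosedNbhd G C a → ¬ InClosedNbhd (deleteEdge G x y) C a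
    ∉N⇒∉N′ a a∉N = a∉N ∘ to (N[C]-deleteEdge x∉C y∉C a)

  alphaCritical⇔ : AlphaCritical G x y ⇔ (E G x y × ¬ ¬ RaisesAlpha G x y)
  alphaCritical⇔ = mk⇔
    (λ (xy , α<α-xy) → xy , λ no-W →
      maxStable-exists G λ (S , S-max) → maxStable-exists (deleteEdge G x y) λ (W , W-max) →
        no-W (W , proj₁ W-max , λ T T-stable →
          ≤-<-trans (proj₂ S-max T T-stable) (α<α-xy _ _ (S , S-max , refl) (W , W-max , refl))))
    (λ (xy , raises) → xy , λ { _ _ (S , S-max , refl) (W , W-max , refl) →
      decidable-stable (∣ S ∣ <? ∣ W ∣) (¬¬-map (λ (W′ , W′-stable , α<∣W′∣) →
        <-≤-trans (α<∣W′∣ S (proj₁ S-max)) (proj₂ W-max W′ W′-stable)) raises) })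

  module _ (W-stable : Stable (deleteEdge G x y) W) (α<∣W∣ : α[ G ]< ∣ W ∣) where

    endpoint∈ : x ∈ W
    endpoint∈ = decidable-stable (x ∈? W) λ x∉W →
      <-irrefl refl (α<∣W∣ W (stable-deleteEdge⁻ W-stable x∉W))

    W-x-maxStable : MaxStable G (W - x)
    W-x-maxStable =
      stable-deleteEdge⁻ (stable-⊆ (deleteEdge G x y) (p─q⊆p W ⁅ x ⁆) W-stable) (x∉p-x W x) ,
      λ T T-stable → ≤-pred (subst (∣ T ∣ <_) (x∈p⇒∣p∣≡1+∣p-x∣ endpoint∈) (α<∣W∣ T T-stable))

module _ (G : SGraph n) (C : Subset n) where

  endpoint∉N : C ⊆⋂Ω G → E G x y → Stable (deleteEdge G x y) W → α[ G ]< ∣ W ∣ → ¬ InClosedNbhd G C x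
  endpoint∉N {x} {y} {W} C⊆⋂Ω xy W-stable α<∣W∣ = ∈∉maxStable⇒∉N[C] G C C⊆⋂Ω
    (W-x-maxStable G x y W-stable α<∣W∣)
    (W-x-maxStable G y x (stable-≅ (deleteEdge-sym G x y) W-stable) α<∣W∣)
    (x∉p-x W x)
    (x∈p∧x≢y⇒x∈p-y (endpoint∈ G x y W-stable α<∣W∣) λ { refl → E-irr G xy })

  alphaCritical⇒∉N : C ⊆⋂Ω G → AlphaCritical G x y → ¬ InClosedNbhd G C x × ¬ InClosedNbhd G C y
  alphaCritical⇒∉N {x} {y} C⊆⋂Ω critical =
    let xy , raises = to (alphaCritical⇔ G x y) critical in
    (λ x∈N → raises λ (W , W-stable , α<∣W∣) → endpoint∉N C⊆⋂Ω xy W-stable α<∣W∣ x∈N) ,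
    (λ y∈N → raises λ (W , W-stable , α<∣W∣) →
      endpoint∉N C⊆⋂Ω (E-sym G xy) (stable-≅ (deleteEdge-sym G x y) W-stable) α<∣W∣ y∈N)

  C⊆raising-stable : C ⊆⋂Ω G → Stable (deleteEdge G x y) W → α[ G ]< ∣ W ∣ → C ⊆ W
  C⊆raising-stable {x} {y} {W} C⊆⋂Ω W-stable α<∣W∣ =
    p─q⊆p W ⁅ x ⁆ ∘ C⊆⋂Ω (W-x-maxStable G x y W-stable α<∣W∣)

  raisesAlpha-─N⇔ : Stable G C → C ⊆⋂Ω G → x ∉ C → y ∉ C → RaisesAlpha G x y ⇔ RaisesAlpha (G ─N[ C ]) x y
  raisesAlpha-─N⇔ {x} {y} C-stable C⊆⋂Ω x∉C y∉C = mk⇔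
    (λ (W , W-stable , α<∣W∣) →
      let C⊆W = C⊆raising-stable C⊆⋂Ω W-stable α<∣W∣ in
      W ─ C ,
      stable-≅ (deleteEdge-─N G x y x∉C y∉C) (stable-─ (deleteEdge G x y) C C⊆W W-stable) ,
      α<-─N G C C-stable (subst (α[ G ]<_) (∣p∣≡∣p─q∣+∣q∣ W C C⊆W) α<∣W∣))
    (λ (W₀ , W₀-stable , α₀<∣W₀∣) →
      let W₀-stable′ = stable-≅ (≅-sym (deleteEdge-─N G x y x∉C y∉C)) W₀-stable in
      W₀ ∪ C ,
      stable-∪ (deleteEdge G x y) C (stable-deleteEdge G x y C-stable) W₀-stable′ ,
      subst (α[ G ]<_) (sym (∣T∪C∣≡∣T∣+∣C∣ (deleteEdge G x y) C W₀-stable′)) (α<-+ G C C⊆⋂Ω α₀<∣W₀∣))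

  alphaCritical-─N⇔ : Stable G C → C ⊆⋂Ω G → AlphaCritical G x y ⇔ AlphaCritical (G ─N[ C ]) x y
  alphaCritical-─N⇔ {x} {y} C-stable C⊆⋂Ω = mk⇔
    (λ critical →
      let xy , raises = to (alphaCritical⇔ G x y) critical
          x∉N , y∉N   = alphaCritical⇒∉N C⊆⋂Ω critical
      in from (alphaCritical⇔ (G ─N[ C ]) x y)
           ((xy , x∉N , y∉N) , ¬¬-map (to (raisesAlpha-─N⇔ C-stable C⊆⋂Ω (x∉N ∘ inj₁) (y∉N ∘ inj₁))) raises))
    (λ critical₀ →
      let (xy , x∉N , y∉N) , raises₀ = to (alphaCritical⇔ (G ─N[ C ]) x y) critical₀
      in from (alphaCritical⇔ G x y)
           (xy , ¬¬-map (from (raisesAlpha-─N⇔ C-stable C⊆⋂Ω (x∉N ∘ inj₁) (y∉N ∘ inj₁))) raises₀))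

lemma3p4 : ∀ {n} (G : SGraph n) (C : Subset n) → IsGraph G → IsCore G C →
    let G₀ = G ─V InClosedNbhd G C in
    (∀ x y → AlphaCritical G x y → ¬ InClosedNbhd G C x × ¬ InClosedNbhd G C y)
    × (∀ a a₀ → IsAlpha G a → IsAlpha G₀ a₀ → a ≡ a₀ + ∣ C ∣)
    × (∀ T → MaxStable G₀ T ⇔ (∃[ S ] (MaxStable G S × (∀ x → x ∈ T ⇔ (x ∈ S × V G₀ x)))))
    × (∀ x → ¬ (V G₀ x × (∀ S → MaxStable G₀ S → x ∈ S)))
    × (∀ x y → AlphaCritical G x y ⇔ AlphaCritical G₀ x y)
lemma3p4 G C _ C-core =
    (λ _ _ → alphaCritical⇒∉N G C C⊆⋂Ω)
  , (λ { _ _ (S , S-max , refl) (T , T-max , refl) → maxStable-∣∣-─N G C C-stable C⊆⋂Ω S-max T-max })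
  , (λ _ → maxStable-─N⇔ G C C-stable C⊆⋂Ω)
  , (λ _ → core-─N[core]-empty G C C-core)
  , (λ _ _ → alphaCritical-─N⇔ G C C-stable C⊆⋂Ω)
  where
  C-stable : Stable G C
  C-stable = core-stable G C C-core

  C⊆⋂Ω : C ⊆⋂Ω G
  C⊆⋂Ω = core-⊆⋂Ω G C C-core
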